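{- Let $D'\le n'$ be positive integers. Consider any algorithm $A$ that solves rendezvous for agents with labels from the set $\{1,\dots,L\}$. There exist $n\in\Theta(n')$ and $D\in\Theta(D')$ such that if $A$ uses time $O(D)$ in the $n$-node oriented ring whenever the initial distance between the agents is $D$, then the required size of advice is $\Omega(\log\log L)$.
   Context: Rendezvous model: the network is an undirected connected graph with $n$ unlabeled nodes; at each node $v$ of degree $d$ the incident edges carry distinct port numbers $0,\dots,d-1$. Two agents start at different nodes and move in synchronous rounds: in each round an agent either stays or chooses a port and moves along the corresponding edge; on entering a node it learns the degree and entry port. Agents cannot mark nodes, cannot communicate before meeting, and do not notice crossing inside an edge. Each agent has a distinct label from $\{1,\dots,L\}$, knows its own label but not the other's. The adversary wakes the agents possibly in different rounds. Both run the same deterministic algorithm with inputs its own label and an advice string given identically to both agents by an oracle knowing the whole instance (graph, port numbering, starting positions, wake-up rounds, both labels); the size of advice is the length of this string. Rendezvous means both agents at the same node in the same round; time is the number of rounds from the wake-up of the later agent until the meeting. An oriented ring is a cycle in which every edge has port number $0$ at one endpoint and $1$ at the other, so that at each node taking port $0$ means going clockwise and port $1$ going counterclockwise. -}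

module Defs where

open import Data.Nat using (ℕ; zero; suc; _+_; _*_; _∸_; _≤_; _<_; _⊓_; _⊔_; ∣_-_∣)
open import Data.Nat.Logarithm using (⌊log₂_⌋)
open import Data.Integer as ℤ using (ℤ; +_; -_)
open import Data.Integer.Divisibility renaming (_∣_ to _∣ℤ_)
open import Data.List using (List; []; _∷_; _++_; [_])
open import Data.Bool using (Bool)
open import Data.Product using (∃; _×_; _,_)
open import Relation.Binary.PropositionalEquality using (_≡_; _≢_)

-- An action in one round in an oriented ring: stay, take port 0
-- (clockwise, +1), or take port 1 (counterclockwise, -1).
data Move : Set where
  stay cw ccw : Move

effect : Move → ℤ
effect stay = + 0
effect cw   = + 1
effect ccw  = - (+ 1)

disp : List Move → ℤ
disp []       = + 0
disp (m ∷ ms) = effect m ℤ.+ disp ms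

Advice : Set
Advice = List Bool

-- In an oriented ring
-- every node has degree 2 and the entry port is determined by the previous
-- move, so the observation history is equivalent to the own-move history.
RingAlgorithm : Set
RingAlgorithm = ℕ → Advice → List Move → Move

history : RingAlgorithm → ℕ → Advice → ℕ → List Move
history A ℓ adv zero    = []
history A ℓ adv (suc k) = history A ℓ adv k ++ [ A ℓ adv (history A ℓ adv k) ]

-- An instance: ring size, starting nodes (0..size-1, numbered clockwise),
-- wake-up rounds and labels of the two agents.
record Instance : Set where
  constructor inst
  field
    size start₁ start₂ wake₁ wake₂ label₁ label₂ : ℕ
open Instance public

Valid : ℕ → Instance → Set
Valid L I = (3 ≤ size I) × (start₁ I < size I) × (start₂ I < size I) × (start₁ I ≢ start₂ I)
          × (1 ≤ label₁ I) × (label₁ I ≤ L) × (1 ≤ label₂ I) × (label₂ I ≤ L) × (label₁ I ≢ label₂ I)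

Oracle : Set
Oracle = Instance → Advice

ringDist : Instance → ℕ
ringDist I = ∣ start₁ I - start₂ I ∣ ⊓ (size I ∸ ∣ start₁ I - start₂ I ∣)

-- positions (as integers, read modulo size) at global round t
pos₁ pos₂ : RingAlgorithm → Oracle → Instance → ℕ → ℤ
pos₁ A O I t = + start₁ I ℤ.+ disp (history A (label₁ I) (O I) (t ∸ wake₁ I))
pos₂ A O I t = + start₂ I ℤ.+ disp (history A (label₂ I) (O I) (t ∸ wake₂ I))

MeetAt : RingAlgorithm → Oracle → Instance → ℕ → Set
MeetAt A O I t = (+ size I) ∣ℤ (pos₁ A O I t ℤ.- pos₂ A O I t)

MeetsWithin : RingAlgorithm → Oracle → Instance → ℕ → Set
MeetsWithin A O I T = ∃ λ t → (t ≤ (wake₁ I ⊔ wake₂ I) + T) × MeetAt A O I t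

Solves : ℕ → RingAlgorithm → Oracle → Set
Solves L A O = ∀ I → Valid L I → ∃ λ t → MeetAt A O I t

loglog : ℕ → ℕ
loglog L = ⌊log₂ ⌊log₂ L ⌋ ⌋

-- Put two agents at distance D = 4δ in a ring of size n ≥ 8δ, both woken at
-- round 0. An agent's progress u(t) = disp + t is nondecreasing and 2-Lipschitz,
-- and the agents meet at round t only if n divides u₁(t) − u₂(t) − D.
-- Give each label, for every advice string of length ≤ M and every checkpoint
-- jδ with j ≤ 4c, the digit ⌊u(jδ)/δ⌋ mod (8c+1). Two labels with the same
-- digits under the advice of their own instance keep |u₁ − u₂| < 3δ up to
-- round cD, so they do not meet in time. Hence a fast algorithm gives the L
-- labels distinct digit vectors, of which there are at most
-- (8c+1)^(2^(M+1)(4c+1)), and log log L = O(M) for the largest advice length M.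

module Submission where

open import Defs
open import Data.Bool using (Bool; true; false)
open import Data.Empty using (⊥-elim)
open import Data.Fin using (Fin; toℕ; fromℕ<)
import Data.Fin.Properties as Fin
open import Data.Integer as ℤ using (+_)
import Data.Integer.Properties as ℤ
open import Data.Integer.Divisibility using () renaming (_∣_ to _∣ℤ_)
open import Data.Integer.Solver using (module +-*-Solver)
open import Algebra.Properties.CommutativeSemigroup ℤ.+-commutativeSemigroup using (interchange)
open import Data.List using (List; []; _∷_; _++_; [_]; length; map; upTo; cartesianProduct; filter)
open import Data.Nat.ListAction using (sum)
open import Data.Nat.ListAction.Properties using (sum-++)
open import Data.List.Extrema.Nat using (argmax; argmax-all; f[xs]≤f[argmax])
open import Data.List.Membership.Propositional using (_∈_)
open import Data.List.Membership.Propositional.Properties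
  using (∈-++⁺ˡ; ∈-++⁺ʳ; ∈-map⁺; ∈-cartesianProduct⁺; ∈-cartesianProduct⁻; ∈-upTo⁺; ∈-upTo⁻; ∈-filter⁺; ∈-filter⁻)
open import Data.List.Properties using (length-++; length-map; length-upTo; map-++)
open import Data.List.Relation.Unary.All as All using (All)
open import Data.List.Relation.Unary.Any using (here; there)
open import Data.Nat
open import Data.Nat.DivMod
open import Data.Nat.Divisibility using (_∣_; >⇒∤)
open import Data.Nat.Logarithm using (⌊log₂_⌋; ⌊log₂⌋-mono-≤; ⌊log₂[2^n]⌋≡n)
open import Data.Nat.Properties
open import Data.Product using (∃; _×_; _,_; proj₁; proj₂)
open import Function using (_∘_)
open import Relation.Binary.PropositionalEquality hiding ([_])
open import Relation.Nullary using (¬_; yes; no)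
open import Relation.Nullary.Decidable using (¬?)

-- progress ms = disp ms + length ms: the clockwise displacement shifted by the
-- elapsed time, which makes it a nondecreasing natural number.
pace : Move → ℕ
pace stay = 1
pace cw   = 2
pace ccw  = 0

progress : List Move → ℕ
progress ms = sum (map pace ms)

pace≤2 : ∀ m → pace m ≤ 2
pace≤2 stay = s≤s z≤n
pace≤2 cw   = ≤-refl
pace≤2 ccw  = z≤n

effect+1≡pace : ∀ m → effect m ℤ.+ + 1 ≡ + pace m
effect+1≡pace stay = refl
effect+1≡pace cw   = refl
effect+1≡pace ccw  = refl

disp+length≡progress : ∀ ms → disp ms ℤ.+ + length ms ≡ + progress ms
disp+length≡progress []       = refl
disp+length≡progress (m ∷ ms) = begin
  (effect m ℤ.+ disp ms) ℤ.+ (+ 1 ℤ.+ + length ms)  ≡⟨ interchange (effect m) (disp ms) (+ 1) (+ length ms) ⟩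
  (effect m ℤ.+ + 1) ℤ.+ (disp ms ℤ.+ + length ms)  ≡⟨ cong₂ ℤ._+_ (effect+1≡pace m) (disp+length≡progress ms) ⟩
  + (pace m + progress ms)                          ∎
  where open ≡-Reasoning

Nondecreasing 2-Lipschitz : (ℕ → ℕ) → Set
Nondecreasing u = ∀ t r → u t ≤ u (t + r)
2-Lipschitz   u = ∀ t r → u (t + r) ≤ u t + 2 * r

module _ (A : RingAlgorithm) (ℓ : ℕ) (s : Advice) where

  progressAt : ℕ → ℕ
  progressAt t = progress (history A ℓ s t)

  length-history : ∀ t → length (history A ℓ s t) ≡ t
  length-history zero    = refl
  length-history (suc t) = trans (length-++ (history A ℓ s t)) (trans (cong (_+ 1) (length-history t)) (+-comm t 1))

  progressAt-suc : ∀ t → progressAt (suc t) ≡ progressAt t + (pace (A ℓ s (history A ℓ s t)) + 0)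
  progressAt-suc t = trans (cong sum (map-++ pace (history A ℓ s t) _)) (sum-++ (map pace (history A ℓ s t)) _)

  progressAt-nondecreasing : Nondecreasing progressAt
  progressAt-nondecreasing t zero    = ≤-reflexive (cong progressAt (sym (+-identityʳ t)))
  progressAt-nondecreasing t (suc r) = begin
    progressAt t              ≤⟨ progressAt-nondecreasing t r ⟩
    progressAt (t + r)        ≤⟨ m≤m+n _ _ ⟩
    progressAt (t + r) + _    ≡⟨ sym (progressAt-suc (t + r)) ⟩
    progressAt (suc (t + r))  ≡⟨ cong progressAt (sym (+-suc t r)) ⟩
    progressAt (t + suc r)    ∎
    where open ≤-Reasoning

  progressAt-2-Lipschitz : 2-Lipschitz progressAt
  progressAt-2-Lipschitz t zero    = ≤-reflexive (trans (cong progressAt (+-identityʳ t)) (sym (+-identityʳ _)))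
  progressAt-2-Lipschitz t (suc r) = begin
    progressAt (t + suc r)                                     ≡⟨ cong progressAt (+-suc t r) ⟩
    progressAt (suc (t + r))                                   ≡⟨ progressAt-suc (t + r) ⟩
    progressAt (t + r) + (pace (A ℓ s (history A ℓ s (t + r))) + 0)
                                                               ≤⟨ +-mono-≤ (progressAt-2-Lipschitz t r) (≤-trans (≤-reflexive (+-identityʳ _)) (pace≤2 _)) ⟩
    progressAt t + 2 * r + 2                                   ≡⟨ +-assoc (progressAt t) (2 * r) 2 ⟩
    progressAt t + (2 * r + 2)                                 ≡⟨ cong (_+_ (progressAt t)) (trans (+-comm (2 * r) 2) (sym (*-suc 2 r))) ⟩
    progressAt t + 2 * suc r                                   ∎
    where open ≤-Reasoning

  disp-history : ∀ t → disp (history A ℓ s t) ℤ.+ + t ≡ + progressAt t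
  disp-history t = trans (cong (λ k → disp (history A ℓ s t) ℤ.+ + k) (sym (length-history t)))
                         (disp+length≡progress (history A ℓ s t))

equal-quotients⇒< : ∀ δ .{{_ : NonZero δ}} x y → x / δ ≡ y / δ → x < y + δ
equal-quotients⇒< δ x y eq = begin-strict
  x                    ≡⟨ m≡m%n+[m/n]*n x δ ⟩
  x % δ + x / δ * δ    <⟨ +-monoˡ-< _ (m%n<n x δ) ⟩
  δ + x / δ * δ        ≡⟨ cong (λ q → δ + q * δ) eq ⟩
  δ + y / δ * δ        ≤⟨ +-monoʳ-≤ δ (m/n*n≤m y δ) ⟩
  δ + y                ≡⟨ +-comm δ y ⟩
  y + δ                ∎
  where open ≤-Reasoning

-- Comparing u and v only at the start t / δ * δ of the length-δ block
-- containing t loses at most δ, plus 2δ for the slack of u inside the block.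
sameBlock⇒< : ∀ δ .{{_ : NonZero δ}} (u v : ℕ → ℕ) → 2-Lipschitz u → Nondecreasing v →
              ∀ t → u (t / δ * δ) / δ ≡ v (t / δ * δ) / δ → u t < v t + 3 * δ
sameBlock⇒< δ u v lip mono t same = begin-strict
  u t                       ≡⟨ cong u split ⟩
  u (t₀ + r)                ≤⟨ lip t₀ r ⟩
  u t₀ + 2 * r              <⟨ +-monoˡ-< (2 * r) (equal-quotients⇒< δ (u t₀) (v t₀) same) ⟩
  v t₀ + δ + 2 * r          ≤⟨ +-mono-≤ (+-monoˡ-≤ δ (mono t₀ r)) (*-monoʳ-≤ 2 (<⇒≤ (m%n<n t δ))) ⟩
  v (t₀ + r) + δ + 2 * δ    ≡⟨ cong (λ x → v x + δ + 2 * δ) (sym split) ⟩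
  v t + δ + 2 * δ           ≡⟨ +-assoc (v t) δ (2 * δ) ⟩
  v t + 3 * δ               ∎
  where
    open ≤-Reasoning
    t₀ = t / δ * δ
    r  = t % δ
    split : t ≡ t₀ + r
    split = trans (m≡m%n+[m/n]*n t δ) (+-comm r t₀)

digit : (B δ : ℕ) .{{_ : NonZero B}} .{{_ : NonZero δ}} → (ℕ → ℕ) → ℕ → ℕ
digit B δ u j = u (j * δ) / δ % B

-- As long as 2 j < B the reduction modulo B in a digit is lossless.
checkpoint-quotient< : ∀ B δ .{{_ : NonZero δ}} (u : ℕ → ℕ) → 2-Lipschitz u → u 0 ≡ 0 →
                       ∀ j → 2 * j < B → u (j * δ) / δ < B
checkpoint-quotient< B δ u lip u0≡0 j 2j<B = begin-strict
  u (j * δ) / δ          ≤⟨ /-monoˡ-≤ δ (≤-trans (lip 0 (j * δ)) (≤-reflexive (cong (_+ 2 * (j * δ)) u0≡0))) ⟩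
  2 * (j * δ) / δ        ≡⟨ cong (_/ δ) (sym (*-assoc 2 j δ)) ⟩
  2 * j * δ / δ          ≡⟨ m*n/n≡m (2 * j) δ ⟩
  2 * j                  <⟨ 2j<B ⟩
  B                      ∎
  where open ≤-Reasoning

equal-digits⇒< : ∀ B δ .{{_ : NonZero B}} .{{_ : NonZero δ}} (u v : ℕ → ℕ) →
                 2-Lipschitz u → 2-Lipschitz v → Nondecreasing v → u 0 ≡ 0 → v 0 ≡ 0 →
                 ∀ t → 2 * (t / δ) < B → digit B δ u (t / δ) ≡ digit B δ v (t / δ) → u t < v t + 3 * δ
equal-digits⇒< B δ u v lipᵤ lipᵥ monoᵥ u0≡0 v0≡0 t 2j<B eq = sameBlock⇒< δ u v lipᵤ monoᵥ t (begin
  u t₀ / δ        ≡⟨ sym (m<n⇒m%n≡m (checkpoint-quotient< B δ u lipᵤ u0≡0 (t / δ) 2j<B)) ⟩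
  u t₀ / δ % B    ≡⟨ eq ⟩
  v t₀ / δ % B    ≡⟨ m<n⇒m%n≡m (checkpoint-quotient< B δ v lipᵥ v0≡0 (t / δ) 2j<B) ⟩
  v t₀ / δ        ∎)
  where
    open ≡-Reasoning
    t₀ = t / δ * δ

∤-between : ∀ {n x y} → x < y → y < x + n → ¬ (+ n ∣ℤ (+ x ℤ.- + y))
∤-between {n} {x} {y} x<y y<x+n n∣x-y = >⇒∤ {{>-nonZero (m<n⇒0<n∸m x<y)}} y∸x<n n∣y∸x
  where
    y∸x<n : y ∸ x < n
    y∸x<n = subst (y ∸ x <_) (m+n∸m≡n x n) (∸-monoˡ-< y<x+n (<⇒≤ x<y))
    n∣y∸x : n ∣ y ∸ x
    n∣y∸x = subst (n ∣_) (trans (cong ℤ.∣_∣ (trans (ℤ.m-n≡m⊖n x y) (ℤ.⊖-< x<y))) (ℤ.∣-i∣≡∣i∣ (+ (y ∸ x)))) n∣x-y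

-- Label indices i, j < L stand for the labels i + 1 and j + 1.
ringInstance : (n D i j : ℕ) → Instance
ringInstance n D i j = inst n 0 D 0 0 (suc i) (suc j)

meetAt-ringInstance : ∀ A O n D i j t → MeetAt A O (ringInstance n D i j) t →
  let s = O (ringInstance n D i j) in
  + n ∣ℤ (+ progressAt A (suc i) s t ℤ.- + (progressAt A (suc j) s t + D))
meetAt-ringInstance A O n D i j t = subst (+ n ∣ℤ_) (begin
    (+ 0 ℤ.+ dᵢ) ℤ.- (+ D ℤ.+ dⱼ)             ≡⟨ shift dᵢ dⱼ (+ t) (+ D) ⟩
    (dᵢ ℤ.+ + t) ℤ.- ((dⱼ ℤ.+ + t) ℤ.+ + D)   ≡⟨ cong₂ (λ x y → x ℤ.- (y ℤ.+ + D)) (disp-history A (suc i) s t) (disp-history A (suc j) s t) ⟩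
    + uᵢ ℤ.- + (uⱼ + D)                      ∎)
  where
    open ≡-Reasoning
    s  = O (ringInstance n D i j)
    dᵢ = disp (history A (suc i) s t)
    dⱼ = disp (history A (suc j) s t)
    uᵢ = progressAt A (suc i) s t
    uⱼ = progressAt A (suc j) s t
    shift : ∀ a b c d → (+ 0 ℤ.+ a) ℤ.- (d ℤ.+ b) ≡ (a ℤ.+ c) ℤ.- ((b ℤ.+ c) ℤ.+ d)
    shift = solve 4 (λ a b c d → (con (+ 0) :+ a) :- (d :+ b) := (a :+ c) :- ((b :+ c) :+ d)) refl
      where open +-*-Solver

-- With equal digits the two agents' progress stays within 3δ of each other up
-- to time 4cδ, so their distance stays strictly between δ and 7δ.
equal-digits⇒¬meetAt : ∀ (A : RingAlgorithm) (O : Oracle) n δ .{{_ : NonZero δ}} c i j → 7 * δ ≤ n →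
  let s = O (ringInstance n (4 * δ) i j) in
  (∀ k → k ≤ 4 * c → digit (suc (8 * c)) δ (progressAt A (suc i) s) k ≡ digit (suc (8 * c)) δ (progressAt A (suc j) s) k) →
  ∀ t → t ≤ c * (4 * δ) → ¬ MeetAt A O (ringInstance n (4 * δ) i j) t
equal-digits⇒¬meetAt A O n δ c i j 7δ≤n same t t≤ meet =
  ∤-between uᵢ<uⱼ+4δ uⱼ+4δ<uᵢ+n (meetAt-ringInstance A O n (4 * δ) i j t meet)
  where
    open ≤-Reasoning
    s = O (ringInstance n (4 * δ) i j)
    u = progressAt A (suc i) s
    v = progressAt A (suc j) s
    k = t / δ
    k≤4c : k ≤ 4 * c
    k≤4c = begin
      t / δ              ≤⟨ /-monoˡ-≤ δ t≤ ⟩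
      c * (4 * δ) / δ    ≡⟨ cong (_/ δ) (trans (cong (_* δ) (*-comm 4 c)) (*-assoc c 4 δ)) ⟨
      4 * c * δ / δ      ≡⟨ m*n/n≡m (4 * c) δ ⟩
      4 * c              ∎
    2k<B : 2 * k < suc (8 * c)
    2k<B = s≤s (≤-trans (*-monoʳ-≤ 2 k≤4c) (≤-reflexive (sym (*-assoc 2 4 c))))
    sameᵏ = same k k≤4c
    uᵢ<uⱼ+3δ : u t < v t + 3 * δ
    uᵢ<uⱼ+3δ = equal-digits⇒< _ δ u v (progressAt-2-Lipschitz A _ s) (progressAt-2-Lipschitz A _ s)
                 (progressAt-nondecreasing A _ s) refl refl t 2k<B sameᵏ
    uⱼ<uᵢ+3δ : v t < u t + 3 * δ
    uⱼ<uᵢ+3δ = equal-digits⇒< _ δ v u (progressAt-2-Lipschitz A _ s) (progressAt-2-Lipschitz A _ s)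
                 (progressAt-nondecreasing A _ s) refl refl t 2k<B (sym sameᵏ)
    uᵢ<uⱼ+4δ : u t < v t + 4 * δ
    uᵢ<uⱼ+4δ = <-≤-trans uᵢ<uⱼ+3δ (+-monoʳ-≤ (v t) (*-monoˡ-≤ δ (n≤1+n 3)))
    uⱼ+4δ<uᵢ+n : v t + 4 * δ < u t + n
    uⱼ+4δ<uᵢ+n = begin-strict
      v t + 4 * δ              <⟨ +-monoˡ-< (4 * δ) uⱼ<uᵢ+3δ ⟩
      u t + 3 * δ + 4 * δ      ≡⟨ +-assoc (u t) (3 * δ) (4 * δ) ⟩
      u t + (3 * δ + 4 * δ)    ≡⟨ cong (_+_ (u t)) (*-distribʳ-+ δ 3 4) ⟨
      u t + 7 * δ              ≤⟨ +-monoʳ-≤ (u t) 7δ≤n ⟩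
      u t + n                  ∎

fromDigits : ℕ → List ℕ → ℕ
fromDigits B []       = 0
fromDigits B (x ∷ xs) = x + B * fromDigits B xs

fromDigits-< : ∀ {X : Set} B (P : List X) (d : X → ℕ) → (∀ p → d p < B) → fromDigits B (map d P) < B ^ length P
fromDigits-< B []      d d<B = s≤s z≤n
fromDigits-< B (p ∷ P) d d<B = begin-strict
  d p + B * e    <⟨ +-monoˡ-< (B * e) (d<B p) ⟩
  B + B * e      ≡⟨ *-suc B e ⟨
  B * suc e      ≤⟨ *-monoʳ-≤ B (fromDigits-< B P d d<B) ⟩
  B * B ^ length P ∎
  where
    open ≤-Reasoning
    e = fromDigits B (map d P)

digit-unique : ∀ B x y e e′ → x < suc B → y < suc B → x + suc B * e ≡ y + suc B * e′ → x ≡ y × e ≡ e′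
digit-unique B x y e e′ x<B y<B eq = x≡y , *-cancelˡ-≡ e e′ (suc B) (+-cancelˡ-≡ y _ _ (subst (λ z → z + suc B * e ≡ _) x≡y eq))
  where
    last-digit : ∀ z k → z < suc B → (z + suc B * k) % suc B ≡ z
    last-digit z k z<B = trans (cong (λ q → (z + q) % suc B) (*-comm (suc B) k))
                               (trans ([m+kn]%n≡m%n z k (suc B)) (m<n⇒m%n≡m z<B))
    x≡y : x ≡ y
    x≡y = trans (sym (last-digit x e x<B)) (trans (cong (_% suc B) eq) (last-digit y e′ y<B))

fromDigits-injective : ∀ {X : Set} B (P : List X) (d d′ : X → ℕ) → (∀ p → d p < suc B) → (∀ p → d′ p < suc B) →
  fromDigits (suc B) (map d P) ≡ fromDigits (suc B) (map d′ P) → ∀ p → p ∈ P → d p ≡ d′ p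
fromDigits-injective B (q ∷ P) d d′ d<B d′<B eq p (here refl) = proj₁ (digit-unique B (d q) (d′ q) _ _ (d<B q) (d′<B q) eq)
fromDigits-injective B (q ∷ P) d d′ d<B d′<B eq p (there p∈P) =
  fromDigits-injective B P d d′ d<B d′<B (proj₂ (digit-unique B (d q) (d′ q) _ _ (d<B q) (d′<B q) eq)) p p∈P

-- Pigeonhole on the base-(B+1) codes of the digit strings.
distinguished⇒≤^ : ∀ {X : Set} L B (P : List X) (d : ℕ → X → ℕ) → (∀ ℓ p → d ℓ p < suc B) →
  (∀ i j → i < L → j < L → i ≢ j → ¬ (∀ p → p ∈ P → d i p ≡ d j p)) → L ≤ suc B ^ length P
distinguished⇒≤^ L B P d d<B distinct with L ≤? suc B ^ length P
... | yes L≤ = L≤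
... | no  L≰ with Fin.pigeonhole (≰⇒> L≰) code
  where
    code : Fin L → Fin (suc B ^ length P)
    code i = fromℕ< (fromDigits-< (suc B) P (d (toℕ i)) (d<B (toℕ i)))
...   | i , j , i<j , codeᵢ≡codeⱼ = ⊥-elim (distinct (toℕ i) (toℕ j) (Fin.toℕ<n i) (Fin.toℕ<n j) (<⇒≢ i<j)
          (fromDigits-injective B P (d (toℕ i)) (d (toℕ j)) (d<B (toℕ i)) (d<B (toℕ j))
            (trans (sym (Fin.toℕ-fromℕ< _)) (trans (cong toℕ codeᵢ≡codeⱼ) (Fin.toℕ-fromℕ< _)))))

bitStrings : ℕ → List (List Bool)
bitStrings zero    = [ [] ]
bitStrings (suc m) = [] ∷ map (true ∷_) (bitStrings m) ++ map (false ∷_) (bitStrings m)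

length-bitStrings : ∀ m → length (bitStrings m) < 2 ^ suc m
length-bitStrings zero    = s≤s (s≤s z≤n)
length-bitStrings (suc m) = begin-strict
  suc (length (map (true ∷_) S ++ map (false ∷_) S))
      ≡⟨ cong suc (trans (length-++ (map (true ∷_) S)) (cong₂ _+_ (length-map _ S) (length-map _ S))) ⟩
  suc (length S + length S)            <⟨ n<1+n _ ⟩
  suc (suc (length S + length S))      ≡⟨ cong suc (+-suc (length S) (length S)) ⟨
  suc (length S) + suc (length S)      ≤⟨ +-mono-≤ (length-bitStrings m) (length-bitStrings m) ⟩
  2 ^ suc m + 2 ^ suc m                ≡⟨ cong (_+_ (2 ^ suc m)) (+-identityʳ (2 ^ suc m)) ⟨
  2 ^ suc (suc m)                      ∎
  where
    open ≤-Reasoning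
    S = bitStrings m

∈-bitStrings : ∀ {m} (s : List Bool) → length s ≤ m → s ∈ bitStrings m
∈-bitStrings {zero}  []          _          = here refl
∈-bitStrings {suc m} []          _          = here refl
∈-bitStrings {suc m} (true ∷ s)  (s≤s |s|≤m) = there (∈-++⁺ˡ (∈-map⁺ (true ∷_) (∈-bitStrings s |s|≤m)))
∈-bitStrings {suc m} (false ∷ s) (s≤s |s|≤m) = there (∈-++⁺ʳ (map (true ∷_) (bitStrings m)) (∈-map⁺ (false ∷_) (∈-bitStrings s |s|≤m)))

length-cartesianProduct : ∀ {X Y : Set} (xs : List X) (ys : List Y) → length (cartesianProduct xs ys) ≡ length xs * length ys
length-cartesianProduct []       ys = refl
length-cartesianProduct (x ∷ xs) ys = trans (length-++ (map (x ,_) ys)) (cong₂ _+_ (length-map _ ys) (length-cartesianProduct xs ys))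

n<2^n : ∀ n → n < 2 ^ n
n<2^n zero    = s≤s z≤n
n<2^n (suc n) = +-mono-≤ (m^n>0 2 n) (≤-trans (n<2^n n) (m≤m+n (2 ^ n) 0))

^-≤-2^2^ : ∀ B K S m → S ≤ 2 ^ m → B ^ (S * K) ≤ 2 ^ 2 ^ (B * K + m)
^-≤-2^2^ B K S m S≤2^m = begin
  B ^ (S * K)              ≡⟨ cong (B ^_) (*-comm S K) ⟩
  B ^ (K * S)              ≡⟨ ^-*-assoc B K S ⟨
  (B ^ K) ^ S              ≤⟨ ^-monoˡ-≤ S Bᴷ≤ ⟩
  (2 ^ 2 ^ (B * K)) ^ S    ≡⟨ ^-*-assoc 2 (2 ^ (B * K)) S ⟩
  2 ^ (2 ^ (B * K) * S)    ≤⟨ ^-monoʳ-≤ 2 (*-monoʳ-≤ (2 ^ (B * K)) S≤2^m) ⟩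
  2 ^ (2 ^ (B * K) * 2 ^ m) ≡⟨ cong (2 ^_) (^-distribˡ-+-* 2 (B * K) m) ⟨
  2 ^ 2 ^ (B * K + m)      ∎
  where
    open ≤-Reasoning
    Bᴷ≤ : B ^ K ≤ 2 ^ 2 ^ (B * K)
    Bᴷ≤ = begin
      B ^ K                ≤⟨ ^-monoˡ-≤ K (<⇒≤ (n<2^n B)) ⟩
      (2 ^ B) ^ K          ≡⟨ ^-*-assoc 2 B K ⟩
      2 ^ (B * K)          ≤⟨ ^-monoʳ-≤ 2 (<⇒≤ (n<2^n (B * K))) ⟩
      2 ^ 2 ^ (B * K)      ∎

loglog-≤ : ∀ {L} x → L ≤ 2 ^ 2 ^ x → loglog L ≤ x
loglog-≤ {L} x L≤ = subst (loglog L ≤_) (⌊log₂[2^n]⌋≡n x)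
  (⌊log₂⌋-mono-≤ (subst (⌊log₂ L ⌋ ≤_) (⌊log₂[2^n]⌋≡n (2 ^ x)) (⌊log₂⌋-mono-≤ L≤)))

ringInstance-valid : ∀ {L n D i j} → 3 ≤ n → 0 < D → D + D ≤ n → i < L → j < L → i ≢ j → Valid L (ringInstance n D i j)
ringInstance-valid 3≤n 0<D D+D≤n i<L j<L i≢j =
  3≤n , <-trans 0<D D<n , D<n , <⇒≢ 0<D , s≤s z≤n , i<L , s≤s z≤n , j<L , i≢j ∘ suc-injective
  where D<n = <-≤-trans (m<m+n _ 0<D) D+D≤n

ringDist-ringInstance : ∀ {n D} i j → D + D ≤ n → ringDist (ringInstance n D i j) ≡ D
ringDist-ringInstance i j D+D≤n = m≤n⇒m⊓n≡m (m+n≤o⇒m≤o∸n _ D+D≤n)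

checkpointExponent : ℕ → ℕ
checkpointExponent c = suc (8 * c) * suc (4 * c)

adviceFactor labelThreshold : ℕ → ℕ
adviceFactor   c = checkpointExponent c + 2
labelThreshold c = suc (2 ^ 2 ^ (checkpointExponent c + 1))

-- Every advice string of length ≤ M is tried at each of the 4c+1 checkpoints,
-- and the resulting (8c+1)-ary digit strings must separate the L labels.
fast⇒L≤2^2^ : ∀ (A : RingAlgorithm) (O : Oracle) L n δ .{{_ : NonZero δ}} c M → 7 * δ ≤ n →
  (∀ i j → i < L → j < L → i ≢ j → MeetsWithin A O (ringInstance n (4 * δ) i j) (c * (4 * δ))) →
  (∀ i j → i < L → j < L → i ≢ j → length (O (ringInstance n (4 * δ) i j)) ≤ M) →
  L ≤ 2 ^ 2 ^ (checkpointExponent c + suc M)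
fast⇒L≤2^2^ A O L n δ c M 7δ≤n fast short = begin
  L                                          ≤⟨ distinguished⇒≤^ L (8 * c) P d d<B separated ⟩
  suc (8 * c) ^ length P                     ≡⟨ cong (suc (8 * c) ^_) (trans (length-cartesianProduct S checkpoints) (cong (length S *_) (length-upTo _))) ⟩
  suc (8 * c) ^ (length S * suc (4 * c))     ≤⟨ ^-≤-2^2^ (suc (8 * c)) (suc (4 * c)) (length S) (suc M) (<⇒≤ (length-bitStrings M)) ⟩
  2 ^ 2 ^ (checkpointExponent c + suc M)     ∎
  where
    open ≤-Reasoning
    S = bitStrings M
    checkpoints = upTo (suc (4 * c))
    P = cartesianProduct S checkpoints
    d : ℕ → List Bool × ℕ → ℕ
    d i (s , k) = digit (suc (8 * c)) δ (progressAt A (suc i) s) k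
    d<B : ∀ i p → d i p < suc (8 * c)
    d<B i (s , k) = m%n<n (progressAt A (suc i) s (k * δ) / δ) (suc (8 * c))
    separated : ∀ i j → i < L → j < L → i ≢ j → ¬ (∀ p → p ∈ P → d i p ≡ d j p)
    separated i j i<L j<L i≢j same with fast i j i<L j<L i≢j
    ... | t , t≤ , meet = equal-digits⇒¬meetAt A O n δ c i j 7δ≤n
            (λ k k≤4c → same (_ , k) (∈-cartesianProduct⁺ (∈-bitStrings _ (short i j i<L j<L i≢j)) (∈-upTo⁺ (s≤s k≤4c))))
            t t≤ meet

distinctPairs : ℕ → List (ℕ × ℕ)
distinctPairs L = filter (λ p → ¬? (proj₁ p ≟ proj₂ p)) (cartesianProduct (upTo L) (upTo L))

maximal-distinct-pair : ∀ L (f : ℕ → ℕ → ℕ) → 1 < L →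
  ∃ λ i → ∃ λ j → i < L × j < L × i ≢ j × (∀ i′ j′ → i′ < L → j′ < L → i′ ≢ j′ → f i′ j′ ≤ f i j)
maximal-distinct-pair L f 1<L = i , j , i<L , j<L , i≢j , λ i′ j′ i′<L j′<L i′≢j′ →
  All.lookup (f[xs]≤f[argmax] (0 , 1) (distinctPairs L))
    (∈-filter⁺ (λ p → ¬? (proj₁ p ≟ proj₂ p)) (∈-cartesianProduct⁺ (∈-upTo⁺ i′<L) (∈-upTo⁺ j′<L)) i′≢j′)
  where
    DistinctBelow : ℕ × ℕ → Set
    DistinctBelow (i , j) = i < L × j < L × i ≢ j
    best = argmax (λ p → f (proj₁ p) (proj₂ p)) (0 , 1) (distinctPairs L)
    i = proj₁ best
    j = proj₂ best
    best-distinct : DistinctBelow best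
    best-distinct = argmax-all (λ p → f (proj₁ p) (proj₂ p)) {P = DistinctBelow} (<-trans z<s 1<L , 1<L , λ ()) (All.tabulate λ p∈ →
      let (p∈cp , p₁≢p₂) = ∈-filter⁻ (λ p → ¬? (proj₁ p ≟ proj₂ p)) p∈
          (p₁∈ , p₂∈)    = ∈-cartesianProduct⁻ (upTo L) (upTo L) p∈cp
      in ∈-upTo⁻ p₁∈ , ∈-upTo⁻ p₂∈ , p₁≢p₂)
    i<L = proj₁ best-distinct
    j<L = proj₁ (proj₂ best-distinct)
    i≢j = proj₂ (proj₂ best-distinct)

-- Below the threshold the bound L ≤ 2^2^(E+1+M) forces M ≠ 0, which is what
-- lets the additive E + 1 be absorbed into a factor of M.
loglog≤adviceFactor* : ∀ {L} c M → labelThreshold c ≤ L → L ≤ 2 ^ 2 ^ (checkpointExponent c + suc M) →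
                       loglog L ≤ adviceFactor c * M
loglog≤adviceFactor* c zero    L₀≤L L≤ = ⊥-elim (<⇒≱ L₀≤L L≤)
loglog≤adviceFactor* {L} c (suc m) L₀≤L L≤ = begin
  loglog L                ≤⟨ loglog-≤ (E + suc (suc m)) L≤ ⟩
  E + suc (suc m)         ≡⟨ +-assoc E 2 m ⟨
  E + 2 + m               ≤⟨ +-monoʳ-≤ (E + 2) (m≤n*m m (E + 2) {{subst NonZero (+-comm 2 E) _}}) ⟩
  E + 2 + (E + 2) * m     ≡⟨ *-suc (E + 2) m ⟨
  (E + 2) * suc m         ∎
  where
    open ≤-Reasoning
    E = checkpointExponent c

advice-lower-bound : ∀ L n δ .{{_ : NonZero δ}} c (A : RingAlgorithm) (O : Oracle) →
  3 ≤ n → 8 * δ ≤ n → labelThreshold c ≤ L →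
  (∀ I → Valid L I → size I ≡ n → ringDist I ≡ 4 * δ → MeetsWithin A O I (c * (4 * δ))) →
  ∃ λ I → Valid L I × (size I ≡ n) × (ringDist I ≡ 4 * δ) × (loglog L ≤ adviceFactor c * length (O I))
advice-lower-bound L n δ c A O 3≤n 8δ≤n L₀≤L fast =
  let (i , j , i<L , j<L , i≢j , maximal) = maximal-distinct-pair L (λ i j → length (O (ringInstance n (4 * δ) i j))) 1<L
      M = length (O (ringInstance n (4 * δ) i j))
  in ringInstance n (4 * δ) i j , valid i<L j<L i≢j , refl , ringDist-ringInstance i j 4δ+4δ≤n ,
     loglog≤adviceFactor* c M L₀≤L (fast⇒L≤2^2^ A O L n δ c M 7δ≤n
       (λ i′ j′ i′<L j′<L i′≢j′ → fast (ringInstance n (4 * δ) i′ j′) (valid i′<L j′<L i′≢j′) refl (ringDist-ringInstance i′ j′ 4δ+4δ≤n))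
       maximal)
  where
    1<L : 1 < L
    1<L = ≤-trans (s≤s (m^n>0 2 (2 ^ (checkpointExponent c + 1)))) L₀≤L
    4δ+4δ≤n : 4 * δ + 4 * δ ≤ n
    4δ+4δ≤n = subst (_≤ n) (*-distribʳ-+ δ 4 4) 8δ≤n
    7δ≤n : 7 * δ ≤ n
    7δ≤n = ≤-trans (*-monoˡ-≤ δ (n≤1+n 7)) 8δ≤n
    valid : ∀ {i j} → i < L → j < L → i ≢ j → Valid L (ringInstance n (4 * δ) i j)
    valid = ringInstance-valid 3≤n (*-monoʳ-< 4 (>-nonZero⁻¹ δ)) 4δ+4δ≤n

theorem3 : ∃ λ (a : ℕ) → ∃ λ (b : ℕ) → ∃ λ (k : ℕ → ℕ) → ∃ λ (L₀ : ℕ → ℕ) →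
             ∀ (L n′ D′ : ℕ) → 1 ≤ D′ → D′ ≤ n′ →
             ∀ (A : RingAlgorithm) (O : Oracle) → Solves L A O →
             ∃ λ (n : ℕ) → ∃ λ (D : ℕ) →
               (n′ ≤ a * n) × (n ≤ b * n′) × (D′ ≤ a * D) × (D ≤ b * D′) × (3 ≤ n) ×
               (∀ (c : ℕ) → L₀ c ≤ L →
                 (∀ I → Valid L I → size I ≡ n → ringDist I ≡ D → MeetsWithin A O I (c * D)) →
                 ∃ λ I → Valid L I × (size I ≡ n) × (ringDist I ≡ D) ×
                   (loglog L ≤ k c * length (O I)))
theorem3 = 1 , 8 , adviceFactor , labelThreshold , λ where
  L n′ (suc d) _ D′≤n′ A O _ →
    let δ   = suc d
        3≤n = ≤-trans (m≤m+n 3 5) (*-monoʳ-≤ 8 (≤-trans (s≤s z≤n) D′≤n′))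
    in 8 * n′ , 4 * δ ,
       ≤-trans (m≤n*m n′ 8) (m≤m+n _ 0) , ≤-refl , ≤-trans (m≤n*m δ 4) (m≤m+n _ 0) , *-monoˡ-≤ δ (m≤m+n 4 4) , 3≤n ,
       λ c → advice-lower-bound L (8 * n′) δ c A O 3≤n (*-monoʳ-≤ 8 D′≤n′)
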